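{- Let $n\geq 2$. The maximum size of a connected graph $G$ of order $n$ with $mvd(G)=2$ is $1$ if $n=2$; $4$ if $n=4$; $7$ if $n=5$; and $\frac{n(n-1)}{2}-4$ if $n\geq 6$. For $n=3$ there is no connected graph of order $3$ with $mvd(G)=2$.
   Context: All graphs are finite, simple and undirected. For a vertex-colored graph and two nonadjacent vertices $x,y$, an $x$-$y$ vertex cut is a set $S\subseteq V(G)\setminus\{x,y\}$ such that $x$ and $y$ lie in different components of $G-S$; it is monochromatic if all its vertices have the same color. A vertex-coloring is an MVD-coloring if every pair of nonadjacent vertices has a monochromatic vertex cut separating them. $mvd(G)$ is the maximum number of colors used by an MVD-coloring of $G$. -}

module Defs where

open import Data.Nat using (ℕ; zero; suc; _+_; _*_; _∸_; _≤_; _<ᵇ_)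
open import Data.Nat.DivMod using (_/_)
open import Data.Fin using (Fin; toℕ)
open import Data.Bool using (Bool; true; false; _∧_; if_then_else_)
open import Data.List using (map; allFin)
open import Data.Nat.ListAction using (sum)
open import Data.Product using (Σ; ∃; _×_)
open import Relation.Binary.PropositionalEquality using (_≡_; _≢_)
open import Relation.Nullary using (¬_)

record Graph (n : ℕ) : Set where
  field
    adj    : Fin n → Fin n → Bool
    sym    : ∀ x y → adj x y ≡ adj y x
    irrefl : ∀ x → adj x x ≡ false
open Graph public

VSet : ℕ → Set
VSet n = Fin n → Bool

∅ : ∀ {n} → VSet n
∅ _ = false

data Reach {n : ℕ} (G : Graph n) (S : VSet n) (x : Fin n) : Fin n → Set where
  here : S x ≡ false → Reach G S x x
  step : ∀ {y z} → Reach G S x y → adj G y z ≡ true → S z ≡ false → Reach G S x z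

Connected : ∀ {n} → Graph n → Set
Connected G = ∀ x y → Reach G ∅ x y

IsVertexCut : ∀ {n} → Graph n → VSet n → Fin n → Fin n → Set
IsVertexCut G S x y = (S x ≡ false) × (S y ≡ false) × ¬ Reach G S x y

Monochromatic : ∀ {n k} → (Fin n → Fin k) → VSet n → Set
Monochromatic c S = ∀ u v → S u ≡ true → S v ≡ true → c u ≡ c v

IsMVDColoring : ∀ {n k} → Graph n → (Fin n → Fin k) → Set
IsMVDColoring G c = ∀ x y → x ≢ y → adj G x y ≡ false →
  Σ (VSet _) (λ S → IsVertexCut G S x y × Monochromatic c S)

-- c uses exactly k colors.
Surjective : ∀ {n k} → (Fin n → Fin k) → Set
Surjective c = ∀ j → ∃ (λ i → c i ≡ j)

HasMVDColoring : ∀ {n} → Graph n → ℕ → Set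
HasMVDColoring {n} G k = Σ (Fin n → Fin k) (λ c → IsMVDColoring G c × Surjective c)

MVD≡ : ∀ {n} → Graph n → ℕ → Set
MVD≡ G k = HasMVDColoring G k × (∀ m → HasMVDColoring G m → m ≤ k)

size : ∀ {n} → Graph n → ℕ
size {n} G = sum (map (λ i → sum (map (λ j →
  if (toℕ i <ᵇ toℕ j) ∧ adj G i j then 1 else 0) (allFin n))) (allFin n))

MaxSizeMVD2 : ℕ → ℕ → Set
MaxSizeMVD2 n m =
  Σ (Graph n) (λ G → Connected G × MVD≡ G 2 × size G ≡ m) ×
  (∀ (G : Graph n) → Connected G → MVD≡ G 2 → size G ≤ m)

-- If v₁ ≠ v₂ and a third vertex exists, colouring v₁ and v₂ with colours of their own and everything else
-- with a third one is an MVD-colouring unless some non-edge has both endpoints adjacent to v₁ or v₂: otherwise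
-- the neighbourhood of a suitable endpoint of each non-edge is a monochromatic cut. So when mvd(G) = 2,
-- applying this to a non-edge xy gives a non-edge uv disjoint from it, which already rules out order 3.
-- A further vertex w either misses one of x, y, u, v, giving a new non-edge (two such vertices give two),
-- or is a common neighbour of both pairs. In that case a vertex b coloured differently from w lies in neither
-- monochromatic cut (both contain w), so b misses a vertex of each pair: either b is outside both pairs and
-- gives two new non-edges, or b lies in one pair and misses a vertex of the other, and the first observation
-- applied to that crossing non-edge gives a fourth. Hence at least 2, 3 and 4 of the n(n-1)/2 pairs are
-- non-edges for n = 4, 5 and n ≥ 6, and these bounds are attained by C₄, the complement of P₃ + K₂, and
-- K_{n-5} ∨ P̄₅.

module Submission where

open import Defs hiding (sym)

open import Data.Bool using (Bool; true; false; not; _∧_; _∨_; if_then_else_)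
import Data.Bool.Properties as Bool
open import Data.Empty using (⊥-elim)
open import Data.Fin using (Fin; zero; suc; toℕ; _≟_)
open import Data.Fin.Patterns
open import Data.Fin.Properties using (all?; any?; injective⇒≤; toℕ-injective; suc-injective; 0≢1+n)
open import Data.List using (List; []; _∷_; _++_; map; length; lookup; allFin; cartesianProduct)
open import Data.List.Membership.Propositional using (_∈_)
open import Data.List.Membership.Propositional.Properties using (∈-allFin; ∈-cartesianProduct⁺)
open import Data.List.Properties
  using (map-∘; map-++; map-cong; map-cong-local; length-map; map-tabulate; length-tabulate)
open import Data.List.Relation.Binary.Subset.Propositional using (_⊆_)
open import Data.List.Relation.Unary.All as All using (All; []; _∷_)
import Data.List.Relation.Unary.All.Properties as Allₚ
open import Data.List.Relation.Unary.All.Properties.Core using (¬Any⇒All¬)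
open import Data.List.Relation.Unary.AllPairs using (AllPairs; []; _∷_)
import Data.List.Relation.Unary.AllPairs.Properties as AllPairs
open import Data.List.Relation.Unary.Any using (here; there; index)
open import Data.List.Relation.Unary.Any.Properties using (lookup-index)
open import Data.List.Relation.Unary.Unique.Propositional using (Unique)
open import Data.Nat using (ℕ; zero; suc; _+_; _*_; _∸_; _≤_; _<_; z≤n; s≤s; _<ᵇ_)
open import Data.Nat.DivMod using (_/_; m*n/n≡m)
open import Data.Nat.ListAction using (sum)
open import Data.Nat.ListAction.Properties using (sum-++)
open import Data.Nat.Properties
  using (≤-refl; ≤-trans; ≤-reflexive; n≤1+n; <⇒≱; +-assoc; +-mono-≤; +-monoʳ-≤; *-distribʳ-+;
         +-commutativeSemigroup; m+n≤o⇒m≤o∸n; m+n∸n≡m; m≤n⇒∃[o]m+o≡n; module ≤-Reasoning)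
open import Algebra.Properties.CommutativeSemigroup +-commutativeSemigroup
  using (x∙yz≈y∙xz) renaming (interchange to +-interchange)
open import Data.Nat.Tactic.RingSolver using (solve-∀)
open import Data.Product using (∃; ∃₂; _×_; _,_; proj₁; proj₂; uncurry)
open import Data.Product.Properties using (≡-dec)
open import Data.Sum using (_⊎_; inj₁; inj₂; [_,_])
import Data.Sum as Sum
open import Data.Vec.Functional using () renaming (_∷_ to _◂_)
open import Function using (_∘_; id)
open import Relation.Binary.Definitions using (DecidableEquality)
open import Relation.Binary.PropositionalEquality hiding ([_])
open import Relation.Nullary using (¬_; Dec; yes; no; ¬?; contradiction)
open import Relation.Nullary.Decidable
  using (⌊_⌋; _×-dec_; _⊎-dec_; _→-dec_; decidable-stable; from-yes)

-- Cuts, neighbourhoods and colourings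

module _ {n : ℕ} (G : Graph n) where

  NonAdjacent : Fin n → Fin n → Set
  NonAdjacent s t = s ≢ t × adj G s t ≡ false

  CommonNeighbour : Fin n → Fin n → Fin n → Set
  CommonNeighbour x y w = adj G w x ≡ true × adj G w y ≡ true

module _ {n : ℕ} {G : Graph n} where

  nonAdjacent-sym : ∀ {s t} → NonAdjacent G s t → NonAdjacent G t s
  nonAdjacent-sym {s} {t} (s≢t , st) = s≢t ∘ sym , trans (Graph.sym G t s) st

  nonAdjacent? : ∀ s t → Dec (NonAdjacent G s t)
  nonAdjacent? s t = ¬? (s ≟ t) ×-dec (adj G s t Bool.≟ false)

  reach-avoids : ∀ {S x y} → Reach G S x y → S y ≡ false
  reach-avoids (here x∉S) = x∉S
  reach-avoids (step _ _ z∉S) = z∉S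

  reach-++ : ∀ {S x y z} → Reach G S x y → Reach G S y z → Reach G S x z
  reach-++ p (here _) = p
  reach-++ p (step q e z∉S) = step (reach-++ p q) e z∉S

  reach-sym : ∀ {S x y} → Reach G S x y → Reach G S y x
  reach-sym (here x∉S) = here x∉S
  reach-sym {y = z} (step {y} p e z∉S) =
    reach-++ (step (here z∉S) (trans (Graph.sym G z y) e) (reach-avoids p)) (reach-sym p)

  connected-via : ∀ h → (∀ x → Reach G ∅ x h) → Connected G
  connected-via h reach x y = reach-++ (reach x) (reach-sym (reach y))

  neighbourhood-separates : ∀ {s t} → NonAdjacent G s t → IsVertexCut G (adj G t) s t
  neighbourhood-separates {s} {t} (s≢t , st) = trans (Graph.sym G t s) st , irrefl G t , no-path
    where
    no-path : ¬ Reach G (adj G t) s t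
    no-path (here _) = s≢t refl
    no-path (step {y} p yt _) with () ← trans (sym yt) (trans (Graph.sym G y t) (reach-avoids p))

  neighbourhood-separates′ : ∀ {s t} → NonAdjacent G s t → IsVertexCut G (adj G s) s t
  neighbourhood-separates′ st with s∉ , t∉ , no-path ← neighbourhood-separates (nonAdjacent-sym st) =
    t∉ , s∉ , no-path ∘ reach-sym

  common-neighbour-in-cut : ∀ {S x y w} → IsVertexCut G S x y → CommonNeighbour G x y w → S w ≡ true
  common-neighbour-in-cut {S} {x} {y} {w} (x∉S , y∉S , no-path) (wx , wy) with S w in w∈S
  ... | true = refl
  ... | false = ⊥-elim (no-path (step (step (here x∉S) (trans (Graph.sym G x w) wx) w∈S) wy y∉S))

  ¬common⇒nonadjacent : ∀ {x y w} → ¬ CommonNeighbour G x y w → adj G w x ≡ false ⊎ adj G w y ≡ false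
  ¬common⇒nonadjacent {x} {y} {w} ¬common with adj G w x | adj G w y
  ... | false | _ = inj₁ refl
  ... | true | false = inj₂ refl
  ... | true | true = ⊥-elim (¬common (refl , refl))

  common-neighbours-same-colour : ∀ {k} {c : Fin n → Fin k} → IsMVDColoring G c →
    ∀ {x y w w′} → NonAdjacent G x y → CommonNeighbour G x y w → CommonNeighbour G x y w′ → c w ≡ c w′
  common-neighbours-same-colour mvd (x≢y , xy) w w′ with S , cut , mono ← mvd _ _ x≢y xy =
    mono _ _ (common-neighbour-in-cut cut w) (common-neighbour-in-cut cut w′)

Painted : ∀ {n k} → (Fin n → Fin k) → Fin k → VSet n → Set
Painted c a S = ∀ v → S v ≡ true → c v ≡ a

painted⇒monochromatic : ∀ {n k} {c : Fin n → Fin k} {a S} → Painted c a S → Monochromatic c S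
painted⇒monochromatic painted u v u∈S v∈S = trans (painted u u∈S) (sym (painted v v∈S))

painted? : ∀ {n k} (c : Fin n → Fin k) a S → Dec (Painted c a S)
painted? c a S = all? λ v → (S v Bool.≟ true) →-dec (c v ≟ a)

monochromatic? : ∀ {n k} (c : Fin n → Fin k) S → Dec (Monochromatic c S)
monochromatic? c S = all? λ u → all? λ v → (S u Bool.≟ true) →-dec ((S v Bool.≟ true) →-dec (c u ≟ c v))

module _ {n : ℕ} (G : Graph n) where

  NeighbourhoodCuts : (VSet n → Set) → Set
  NeighbourhoodCuts P = ∀ s t → NonAdjacent G s t → P (adj G s) ⊎ P (adj G t)

  neighbourhoodCuts? : ∀ {P} → (∀ S → Dec (P S)) → Dec (NeighbourhoodCuts P)
  neighbourhoodCuts? P? = all? λ s → all? λ t →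
    nonAdjacent? {G = G} s t →-dec (P? (adj G s) ⊎-dec P? (adj G t))

  neighbourhood-mvd : ∀ {k} {c : Fin n → Fin k} {P} → (∀ {S} → P S → Monochromatic c S) →
    NeighbourhoodCuts P → IsMVDColoring G c
  neighbourhood-mvd mono cuts s t s≢t st with cuts s t (s≢t , st)
  ... | inj₁ Ps = adj G s , neighbourhood-separates′ (s≢t , st) , mono Ps
  ... | inj₂ Pt = adj G t , neighbourhood-separates (s≢t , st) , mono Pt

surjective⇒≤ : ∀ {n k} {c : Fin n → Fin k} → Surjective c → k ≤ n
surjective⇒≤ {c = c} surj = injective⇒≤ section-injective
  where
  section-injective : ∀ {i j} → proj₁ (surj i) ≡ proj₁ (surj j) → i ≡ j
  section-injective {i} {j} e = trans (sym (proj₂ (surj i))) (trans (cong c e) (proj₂ (surj j)))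

at-most-two-colours : ∀ {n k} {c : Fin n → Fin k} → Surjective c →
  ∀ a b → (∀ v → c v ≡ c a ⊎ c v ≡ c b) → k ≤ 2
at-most-two-colours {k = k} {c = c} surj a b two = surjective⇒≤ {c = colours} hit
  where
  colours : Fin 2 → Fin k
  colours 0F = c a
  colours 1F = c b
  hit : Surjective colours
  hit j with v , refl ← surj j with two v
  ... | inj₁ e = 0F , sym e
  ... | inj₂ e = 1F , sym e

-- Counting non-edges

sum-map-+ : ∀ {A : Set} (f g : A → ℕ) xs →
  sum (map f xs) + sum (map g xs) ≡ sum (map (λ x → f x + g x) xs)
sum-map-+ f g [] = refl
sum-map-+ f g (x ∷ xs) = trans (+-interchange (f x) _ (g x) _) (cong (f x + g x +_) (sum-map-+ f g xs))

sum-map-mono : ∀ {A : Set} {f g : A → ℕ} → (∀ x → f x ≤ g x) → ∀ xs → sum (map f xs) ≤ sum (map g xs)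
sum-map-mono f≤g [] = z≤n
sum-map-mono f≤g (x ∷ xs) = +-mono-≤ (f≤g x) (sum-map-mono f≤g xs)

sum-map-ones : ∀ {A : Set} {f : A → ℕ} {xs} → All (λ x → f x ≡ 1) xs → sum (map f xs) ≡ length xs
sum-map-ones [] = refl
sum-map-ones (fx≡1 ∷ fxs≡1) = cong₂ _+_ fx≡1 (sum-map-ones fxs≡1)

module _ {A : Set} (_≟ᴬ_ : DecidableEquality A) where

  zeroAt : A → (A → ℕ) → A → ℕ
  zeroAt a f x with x ≟ᴬ a
  ... | yes _ = 0
  ... | no _ = f x

  zeroAt-≤ : ∀ a f x → zeroAt a f x ≤ f x
  zeroAt-≤ a f x with x ≟ᴬ a
  ... | yes _ = z≤n
  ... | no _ = ≤-refl

  zeroAt-self : ∀ a f → zeroAt a f a ≡ 0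
  zeroAt-self a f with a ≟ᴬ a
  ... | yes _ = refl
  ... | no a≢a = ⊥-elim (a≢a refl)

  zeroAt-≢ : ∀ {a x} f → a ≢ x → zeroAt a f x ≡ f x
  zeroAt-≢ {a} {x} f a≢x with x ≟ᴬ a
  ... | yes x≡a = ⊥-elim (a≢x (sym x≡a))
  ... | no _ = refl

  sum-zeroAt : ∀ {a ys} f → a ∈ ys → f a + sum (map (zeroAt a f) ys) ≤ sum (map f ys)
  sum-zeroAt {a} {a ∷ ys} f (here refl) rewrite zeroAt-self a f =
    +-monoʳ-≤ (f a) (sum-map-mono (zeroAt-≤ a f) ys)
  sum-zeroAt {a} {y ∷ ys} f (there a∈ys) = begin
    f a + (zeroAt a f y + sum (map (zeroAt a f) ys)) ≡⟨ x∙yz≈y∙xz (f a) (zeroAt a f y) _ ⟩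
    zeroAt a f y + (f a + sum (map (zeroAt a f) ys)) ≤⟨ +-mono-≤ (zeroAt-≤ a f y) (sum-zeroAt f a∈ys) ⟩
    f y + sum (map f ys)                             ∎
    where open ≤-Reasoning

  -- Zeroing f at the head a does not change the sum over the tail (a ∉ xs) and frees f a in the sum over ys.
  sum-unique-≤ : ∀ {xs ys} → Unique xs → xs ⊆ ys → ∀ f → sum (map f xs) ≤ sum (map f ys)
  sum-unique-≤ {[]} _ _ f = z≤n
  sum-unique-≤ {a ∷ xs} {ys} (a∉xs ∷ unique) xs⊆ys f = begin
    f a + sum (map f xs)            ≡⟨ cong (λ l → f a + sum l) (map-cong-local (All.map (zeroAt-≢ f) a∉xs)) ⟨
    f a + sum (map (zeroAt a f) xs) ≤⟨ +-monoʳ-≤ (f a) (sum-unique-≤ unique (xs⊆ys ∘ there) (zeroAt a f)) ⟩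
    f a + sum (map (zeroAt a f) ys) ≤⟨ sum-zeroAt f (xs⊆ys (here refl)) ⟩
    sum (map f ys)                  ∎
    where open ≤-Reasoning

sum-sum≡sum-cartesianProduct : ∀ {A B : Set} (f : A → B → ℕ) xs ys →
  sum (map (λ x → sum (map (f x) ys)) xs) ≡ sum (map (uncurry f) (cartesianProduct xs ys))
sum-sum≡sum-cartesianProduct f [] ys = refl
sum-sum≡sum-cartesianProduct f (x ∷ xs) ys = begin
  sum (map (f x) ys) + sum (map (λ x → sum (map (f x) ys)) xs)
    ≡⟨ cong₂ _+_ (cong sum (map-∘ ys)) (sum-sum≡sum-cartesianProduct f xs ys) ⟩
  sum (map (uncurry f) (map (x ,_) ys)) + sum (map (uncurry f) (cartesianProduct xs ys))
    ≡⟨ sum-++ (map (uncurry f) (map (x ,_) ys)) _ ⟨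
  sum (map (uncurry f) (map (x ,_) ys) ++ map (uncurry f) (cartesianProduct xs ys))
    ≡⟨ cong sum (map-++ (uncurry f) (map (x ,_) ys) _) ⟨
  sum (map (uncurry f) (map (x ,_) ys ++ cartesianProduct xs ys)) ∎
  where open ≡-Reasoning

allPairs : ∀ n → List (Fin n × Fin n)
allPairs n = cartesianProduct (allFin n) (allFin n)

doubleSum : ∀ n → (Fin n → Fin n → ℕ) → ℕ
doubleSum n f = sum (map (λ i → sum (map (f i) (allFin n))) (allFin n))

pairCount : ℕ → ℕ
pairCount n = doubleSum n λ i j → if toℕ i <ᵇ toℕ j then 1 else 0

sum-allFin-suc : ∀ {n} (f : Fin (suc n) → ℕ) →
  sum (map f (allFin (suc n))) ≡ f zero + sum (map (f ∘ suc) (allFin n))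
sum-allFin-suc f = cong (λ l → f zero + sum l) (trans (map-tabulate suc f) (sym (map-tabulate id (f ∘ suc))))

doubleSum-suc : ∀ {n} (f : Fin (suc n) → Fin (suc n) → ℕ) →
  (∀ i → f i zero ≡ 0) → (∀ j → f zero (suc j) ≡ 1) →
  doubleSum (suc n) f ≡ n + doubleSum n (λ i j → f (suc i) (suc j))
doubleSum-suc {n} f column₀≡0 row₀≡1 =
  trans (sum-allFin-suc row)
    (cong₂ _+_ (trans (drop-first zero) first-row) (cong sum (map-cong (drop-first ∘ suc) (allFin n))))
  where
  row : Fin (suc n) → ℕ
  row i = sum (map (f i) (allFin (suc n)))
  drop-first : ∀ i → row i ≡ sum (map (f i ∘ suc) (allFin n))
  drop-first i = trans (sum-allFin-suc (f i)) (cong (_+ sum (map (f i ∘ suc) (allFin n))) (column₀≡0 i))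
  first-row : sum (map (f zero ∘ suc) (allFin n)) ≡ n
  first-row = trans (sum-map-ones (All.universal row₀≡1 (allFin n))) (length-tabulate id)

pairCount-suc : ∀ n → pairCount (suc n) ≡ n + pairCount n
pairCount-suc n = doubleSum-suc {n} (λ i j → if toℕ i <ᵇ toℕ j then 1 else 0) (λ _ → refl) (λ _ → refl)

pairCount≡ : ∀ n → pairCount n ≡ n * (n ∸ 1) / 2
pairCount≡ n = trans (sym (m*n/n≡m (pairCount n) 2)) (cong (_/ 2) (twice n))
  where
  gauss-step : ∀ m → suc m * 2 + suc m * m ≡ suc (suc m) * suc m
  gauss-step = solve-∀
  twice : ∀ n → pairCount n * 2 ≡ n * (n ∸ 1)
  twice zero = refl
  twice (suc zero) = refl
  twice (suc (suc m)) = begin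
    pairCount (suc (suc m)) * 2          ≡⟨ cong (_* 2) (pairCount-suc (suc m)) ⟩
    (suc m + pairCount (suc m)) * 2      ≡⟨ *-distribʳ-+ 2 (suc m) (pairCount (suc m)) ⟩
    suc m * 2 + pairCount (suc m) * 2    ≡⟨ cong (suc m * 2 +_) (twice (suc m)) ⟩
    suc m * 2 + suc m * m                ≡⟨ gauss-step m ⟩
    suc (suc m) * suc m                  ∎
    where open ≡-Reasoning

module _ {n : ℕ} where

  _∈₂_ : Fin n → Fin n × Fin n → Set
  z ∈₂ (a , b) = z ≡ a ⊎ z ≡ b

  _∉₂_ : Fin n → Fin n × Fin n → Set
  z ∉₂ p = ¬ z ∈₂ p

  -- An unordered pair {s, t} is represented by the ordered pair with the smaller vertex first.
  normalise : Fin n × Fin n → Fin n × Fin n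
  normalise (s , t) = if toℕ s <ᵇ toℕ t then (s , t) else (t , s)

  _≢ᵤ_ : Fin n × Fin n → Fin n × Fin n → Set
  p ≢ᵤ q = normalise p ≢ normalise q

  normalise-cases : ∀ s t → ((toℕ s <ᵇ toℕ t) ≡ true × normalise (s , t) ≡ (s , t))
                          ⊎ ((toℕ s <ᵇ toℕ t) ≡ false × normalise (s , t) ≡ (t , s))
  normalise-cases s t with toℕ s <ᵇ toℕ t
  ... | true = inj₁ (refl , refl)
  ... | false = inj₂ (refl , refl)

  ∈₂-normalise : ∀ {z} p → z ∈₂ p → z ∈₂ normalise p
  ∈₂-normalise (s , t) z∈p with normalise-cases s t
  ... | inj₁ (_ , eq) = subst (_ ∈₂_) (sym eq) z∈p
  ... | inj₂ (_ , eq) = subst (_ ∈₂_) (sym eq) (Sum.swap z∈p)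

  ∈₂-normalise⁻ : ∀ {z} p → z ∈₂ normalise p → z ∈₂ p
  ∈₂-normalise⁻ (s , t) z∈p with normalise-cases s t
  ... | inj₁ (_ , eq) = subst (_ ∈₂_) eq z∈p
  ... | inj₂ (_ , eq) = Sum.swap (subst (_ ∈₂_) eq z∈p)

  apart : ∀ {z p q} → z ∈₂ p → z ∉₂ q → p ≢ᵤ q
  apart {p = p} {q} z∈p z∉q eq = z∉q (∈₂-normalise⁻ q (subst (_ ∈₂_) eq (∈₂-normalise p z∈p)))

  apart′ : ∀ {z p q} → z ∉₂ p → z ∈₂ q → p ≢ᵤ q
  apart′ z∉p z∈q = apart z∈q z∉p ∘ sym

  ∉₂-sym : ∀ {s t z p} → s ∉₂ p → t ∉₂ p → z ∈₂ p → z ∉₂ (s , t)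
  ∉₂-sym s∉p _ z∈p (inj₁ refl) = s∉p z∈p
  ∉₂-sym _ t∉p z∈p (inj₂ refl) = t∉p z∈p

<ᵇ-flip : ∀ m n → m ≢ n → (m <ᵇ n) ≡ false → (n <ᵇ m) ≡ true
<ᵇ-flip zero zero m≢n _ = ⊥-elim (m≢n refl)
<ᵇ-flip (suc m) zero _ _ = refl
<ᵇ-flip (suc m) (suc n) m≢n eq = <ᵇ-flip m n (m≢n ∘ cong suc) eq

module _ {n : ℕ} (G : Graph n) where

  nonEdgeIndicator : Fin n × Fin n → ℕ
  nonEdgeIndicator (i , j) = if (toℕ i <ᵇ toℕ j) ∧ not (adj G i j) then 1 else 0

  nonEdgeCount : ℕ
  nonEdgeCount = sum (map nonEdgeIndicator (allPairs n))

  nonEdgeIndicator-normalise : ∀ {s t} → NonAdjacent G s t → nonEdgeIndicator (normalise (s , t)) ≡ 1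
  nonEdgeIndicator-normalise {s} {t} (s≢t , st) with normalise-cases s t
  ... | inj₁ (s<t , eq) rewrite eq | s<t | st = refl
  ... | inj₂ (s≮t , eq) rewrite eq | <ᵇ-flip _ _ (s≢t ∘ toℕ-injective) s≮t | Graph.sym G t s | st = refl

  size+nonEdgeCount : size G + nonEdgeCount ≡ pairCount n
  size+nonEdgeCount = begin
    size G + nonEdgeCount
      ≡⟨ cong (_+ nonEdgeCount) (sum-sum≡sum-cartesianProduct edge (allFin n) (allFin n)) ⟩
    sum (map (uncurry edge) (allPairs n)) + nonEdgeCount
      ≡⟨ sum-map-+ (uncurry edge) nonEdgeIndicator (allPairs n) ⟩
    sum (map (λ p → uncurry edge p + nonEdgeIndicator p) (allPairs n))
      ≡⟨ cong sum (map-cong (λ (i , j) → split (toℕ i <ᵇ toℕ j) (adj G i j)) (allPairs n)) ⟩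
    sum (map (uncurry ordered) (allPairs n))
      ≡⟨ sum-sum≡sum-cartesianProduct ordered (allFin n) (allFin n) ⟨
    pairCount n
      ∎
    where
    open ≡-Reasoning
    edge ordered : Fin n → Fin n → ℕ
    edge i j = if (toℕ i <ᵇ toℕ j) ∧ adj G i j then 1 else 0
    ordered i j = if toℕ i <ᵇ toℕ j then 1 else 0
    split : ∀ a b → (if a ∧ b then 1 else 0) + (if a ∧ not b then 1 else 0) ≡ (if a then 1 else 0)
    split true true = refl
    split true false = refl
    split false _ = refl

record NonEdges {n : ℕ} (G : Graph n) (k : ℕ) : Set where
  constructor nonEdges
  field
    pairs : List (Fin n × Fin n)
    nonAdjacent : All (uncurry (NonAdjacent G)) pairs
    distinct : AllPairs _≢ᵤ_ pairs
    enough : k ≤ length pairs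

module _ {n : ℕ} {G : Graph n} where

  nonEdges-weaken : ∀ {k l} → k ≤ l → NonEdges G l → NonEdges G k
  nonEdges-weaken k≤l (nonEdges ps na d l≤) = nonEdges ps na d (≤-trans k≤l l≤)

  nonEdges≤nonEdgeCount : ∀ {k} → NonEdges G k → k ≤ nonEdgeCount G
  nonEdges≤nonEdgeCount {k} (nonEdges ps na distinct k≤) = begin
    k                                                  ≤⟨ k≤ ⟩
    length ps                                          ≡⟨ length-map normalise ps ⟨
    length (map normalise ps)
      ≡⟨ sum-map-ones (Allₚ.map⁺ (All.map (nonEdgeIndicator-normalise G) na)) ⟨
    sum (map (nonEdgeIndicator G) (map normalise ps))
      ≤⟨ sum-unique-≤ (≡-dec _≟_ _≟_) (AllPairs.map⁺ distinct)
           (λ _ → ∈-cartesianProduct⁺ (∈-allFin _) (∈-allFin _)) _ ⟩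
    nonEdgeCount G                                     ∎
    where open ≤-Reasoning

  size-bound : ∀ {k} → NonEdges G k → size G ≤ pairCount n ∸ k
  size-bound non = m+n≤o⇒m≤o∸n (size G)
    (≤-trans (+-monoʳ-≤ (size G) (nonEdges≤nonEdgeCount non)) (≤-reflexive (size+nonEdgeCount G)))

-- Non-edges forced by mvd(G) = 2

module _ {n : ℕ} where
  open import Data.List.Membership.DecPropositional (_≟_ {n}) using (_∈?_; _∉?_)

  fresh : (xs : List (Fin n)) → length xs < n → ∃ λ w → All (w ≢_) xs
  fresh xs len<n with any? (_∉? xs)
  ... | yes (w , w∉xs) = w , ¬Any⇒All¬ xs w∉xs
  ... | no none = contradiction (injective⇒≤ index-injective) (<⇒≱ len<n)
    where
    member : ∀ w → w ∈ xs
    member w = decidable-stable (w ∈? xs) (none ∘ (w ,_))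
    index-injective : ∀ {v w} → index (member v) ≡ index (member w) → v ≡ w
    index-injective {v} {w} eq =
      trans (lookup-index (member v)) (trans (cong (lookup xs) eq) (sym (lookup-index (member w))))

module _ {n : ℕ} (G : Graph n) (no-three : ¬ HasMVDColoring G 3) where

  Touches : Fin n → Fin n → Fin n → Set
  Touches v₁ v₂ s = adj G s v₁ ≡ true ⊎ adj G s v₂ ≡ true

  touches? : ∀ v₁ v₂ s → Dec (Touches v₁ v₂ s)
  touches? v₁ v₂ s = (adj G s v₁ Bool.≟ true) ⊎-dec (adj G s v₂ Bool.≟ true)

  joint-non-edge : ∀ {v₁ v₂ w} → v₁ ≢ v₂ → w ≢ v₁ → w ≢ v₂ →
    ∃₂ λ s t → NonAdjacent G s t × Touches v₁ v₂ s × Touches v₁ v₂ t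
  joint-non-edge {v₁} {v₂} {w} v₁≢v₂ w≢v₁ w≢v₂
    with any? (λ s → any? λ t → nonAdjacent? {G = G} s t ×-dec touches? v₁ v₂ s ×-dec touches? v₁ v₂ t)
  ... | yes found = found
  ... | no none = ⊥-elim (no-three (χ , neighbourhood-mvd G painted⇒monochromatic cuts , χ-surjective))
    where
    χ : Fin n → Fin 3
    χ v with v ≟ v₁
    ... | yes _ = 1F
    ... | no _ with v ≟ v₂
    ...   | yes _ = 2F
    ...   | no _ = 0F

    χ-other : ∀ {v} → v ≢ v₁ → v ≢ v₂ → χ v ≡ 0F
    χ-other {v} v≢v₁ v≢v₂ with v ≟ v₁
    ... | yes v≡v₁ = ⊥-elim (v≢v₁ v≡v₁)
    ... | no _ with v ≟ v₂
    ...   | yes v≡v₂ = ⊥-elim (v≢v₂ v≡v₂)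
    ...   | no _ = refl

    χ-v₁ : χ v₁ ≡ 1F
    χ-v₁ with v₁ ≟ v₁
    ... | yes _ = refl
    ... | no v₁≢v₁ = ⊥-elim (v₁≢v₁ refl)

    χ-v₂ : χ v₂ ≡ 2F
    χ-v₂ with v₂ ≟ v₁
    ... | yes v₂≡v₁ = ⊥-elim (v₁≢v₂ (sym v₂≡v₁))
    ... | no _ with v₂ ≟ v₂
    ...   | yes _ = refl
    ...   | no v₂≢v₂ = ⊥-elim (v₂≢v₂ refl)

    χ-surjective : Surjective χ
    χ-surjective 0F = w , χ-other w≢v₁ w≢v₂
    χ-surjective 1F = v₁ , χ-v₁
    χ-surjective 2F = v₂ , χ-v₂

    avoiding : ∀ {s} → ¬ Touches v₁ v₂ s → Painted χ 0F (adj G s)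
    avoiding ¬touches v sv = χ-other {v} (λ { refl → ¬touches (inj₁ sv) }) (λ { refl → ¬touches (inj₂ sv) })

    cuts : NeighbourhoodCuts G (Painted χ 0F)
    cuts s t st with touches? v₁ v₂ s | touches? v₁ v₂ t
    ... | no ¬s | _ = inj₁ (avoiding ¬s)
    ... | yes _ | no ¬t = inj₂ (avoiding ¬t)
    ... | yes ts | yes tt = ⊥-elim (none (s , t , st , ts , tt))

  touches⇒∉₂ : ∀ {v₁ v₂ s} → NonAdjacent G v₁ v₂ → Touches v₁ v₂ s → s ∉₂ (v₁ , v₂)
  touches⇒∉₂ {v₁} {v₂} (_ , v₁v₂) = λ
    { (inj₁ sv₁) (inj₁ refl) → true≢false (trans (sym sv₁) (irrefl G v₁))
    ; (inj₁ sv₁) (inj₂ refl) → true≢false (trans (sym sv₁) (trans (Graph.sym G v₂ v₁) v₁v₂))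
    ; (inj₂ sv₂) (inj₁ refl) → true≢false (trans (sym sv₂) v₁v₂)
    ; (inj₂ sv₂) (inj₂ refl) → true≢false (trans (sym sv₂) (irrefl G v₂))
    }
    where
    true≢false : true ≢ false
    true≢false ()

  disjoint-non-edge : ∀ {x y w} → NonAdjacent G x y → w ∉₂ (x , y) →
    ∃₂ λ u v → NonAdjacent G u v × u ∉₂ (x , y) × v ∉₂ (x , y)
  disjoint-non-edge xy@(x≢y , _) w∉xy
    with u , v , uv , tu , tv ← joint-non-edge x≢y (w∉xy ∘ inj₁) (w∉xy ∘ inj₂) =
    u , v , uv , touches⇒∉₂ xy tu , touches⇒∉₂ xy tv

record DisjointNonEdges {n : ℕ} (G : Graph n) : Set where
  field
    x y u v : Fin n
    xy : NonAdjacent G x y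
    uv : NonAdjacent G u v
    u∉xy : u ∉₂ (x , y)
    v∉xy : v ∉₂ (x , y)

  ∈uv⇒∉xy : ∀ {z} → z ∈₂ (u , v) → z ∉₂ (x , y)
  ∈uv⇒∉xy (inj₁ refl) = u∉xy
  ∈uv⇒∉xy (inj₂ refl) = v∉xy

  ∈xy⇒∉uv : ∀ {z} → z ∈₂ (x , y) → z ∉₂ (u , v)
  ∈xy⇒∉uv z∈xy z∈uv = ∈uv⇒∉xy z∈uv z∈xy

  vertices : List (Fin n)
  vertices = x ∷ y ∷ u ∷ v ∷ []

  Outside : Fin n → Set
  Outside w = w ∉₂ (x , y) × w ∉₂ (u , v)

  outside : ∀ {w} → All (w ≢_) vertices → Outside w
  outside (w≢x ∷ w≢y ∷ w≢u ∷ w≢v ∷ []) = [ w≢x , w≢y ] , [ w≢u , w≢v ]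

  exchange : DisjointNonEdges G
  exchange = record
    { x = u ; y = v ; u = x ; v = y ; xy = uv ; uv = xy
    ; u∉xy = ∈xy⇒∉uv (inj₁ refl) ; v∉xy = ∈xy⇒∉uv (inj₂ refl) }

  extend : ∀ {k} ps → All (uncurry (NonAdjacent G)) ps → AllPairs _≢ᵤ_ ps →
    All (λ p → (x , y) ≢ᵤ p × (u , v) ≢ᵤ p) ps → k ≤ 2 + length ps → NonEdges G k
  extend ps na distinct apart-xy-uv k≤ = nonEdges ((x , y) ∷ (u , v) ∷ ps) (xy ∷ uv ∷ na)
    ((apart′ u∉xy (inj₁ refl) ∷ All.map proj₁ apart-xy-uv) ∷ All.map proj₂ apart-xy-uv ∷ distinct) k≤

  apart-outside : ∀ {w p} → w ∈₂ p → Outside w → (x , y) ≢ᵤ p × (u , v) ≢ᵤ p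
  apart-outside w∈p (w∉xy , w∉uv) = apart′ w∉xy w∈p , apart′ w∉uv w∈p

other-endpoint : ∀ {n} {p x y : Fin n} → p ∈₂ (x , y) → x ≢ y → ∃ λ p′ → p′ ∈₂ (x , y) × p′ ≢ p
other-endpoint (inj₁ refl) x≢y = _ , inj₂ refl , x≢y ∘ sym
other-endpoint (inj₂ refl) x≢y = _ , inj₁ refl , x≢y

module ForcedNonEdges {n : ℕ} (G : Graph n) (mvd≡2 : MVD≡ G 2) where

  open DisjointNonEdges

  no-three : ¬ HasMVDColoring G 3
  no-three three = contradiction (proj₂ mvd≡2 3 three) λ { (s≤s (s≤s ())) }

  private
    c : Fin n → Fin 2
    c = proj₁ (proj₁ mvd≡2)

    c-mvd : IsMVDColoring G c
    c-mvd = proj₁ (proj₂ (proj₁ mvd≡2))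

    c-surjective : Surjective c
    c-surjective = proj₂ (proj₂ (proj₁ mvd≡2))

  other-colour : ∀ w → ∃ λ b → c b ≢ c w
  other-colour w with c w
  ... | 0F = let b , cb≡1 = c-surjective 1F in b , λ cb≡0 → 0≢1+n (trans (sym cb≡0) cb≡1)
  ... | 1F = let b , cb≡0 = c-surjective 0F in b , λ cb≡1 → 0≢1+n (trans (sym cb≡0) cb≡1)

  separated : ∀ {p q w b} → NonAdjacent G p q → CommonNeighbour G p q w → c b ≢ c w →
    ∃ λ z → z ∈₂ (p , q) × adj G b z ≡ false
  separated pq w b≢w with ¬common⇒nonadjacent {G = G} (λ b → b≢w (common-neighbours-same-colour c-mvd pq b w))
  ... | inj₁ bp = _ , inj₁ refl , bp
  ... | inj₂ bq = _ , inj₂ refl , bq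

  crossing : ∀ D {p q} → p ∈₂ (x D , y D) → q ∈₂ (u D , v D) → adj G p q ≡ false → NonEdges G 4
  crossing D {p} {q} p∈xy q∈uv pq with p′ , p′∈xy , p′≢p ← other-endpoint p∈xy (proj₁ (xy D)) =
    four (disjoint-non-edge G no-three p≁q p′∉pq)
    where
    p≁q : NonAdjacent G p q
    p≁q = (λ { refl → ∈xy⇒∉uv D p∈xy q∈uv }) , pq
    p′∉pq : p′ ∉₂ (p , q)
    p′∉pq (inj₁ refl) = p′≢p refl
    p′∉pq (inj₂ refl) = ∈xy⇒∉uv D p′∈xy q∈uv
    four : (∃₂ λ s t → NonAdjacent G s t × s ∉₂ (p , q) × t ∉₂ (p , q)) → NonEdges G 4
    four (s , t , st , s∉pq , t∉pq) = extend D ((p , q) ∷ (s , t) ∷ []) (p≁q ∷ st ∷ [])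
      ((apart (inj₁ refl) (∉₂-sym s∉pq t∉pq (inj₁ refl)) ∷ []) ∷ [] ∷ [])
      ((apart′ (∈uv⇒∉xy D q∈uv) (inj₂ refl) , apart′ (∈xy⇒∉uv D p∈xy) (inj₁ refl))
       ∷ (apart p∈xy (∉₂-sym s∉pq t∉pq (inj₁ refl)) , apart q∈uv (∉₂-sym s∉pq t∉pq (inj₂ refl)))
       ∷ [])
      ≤-refl

  four-from-apex : ∀ D {w} → CommonNeighbour G (x D) (y D) w → CommonNeighbour G (u D) (v D) w → NonEdges G 4
  four-from-apex D wxy wuv
    with b , b≢w ← other-colour _
    with p , p∈xy , bp ← separated (xy D) wxy b≢w
    with q , q∈uv , bq ← separated (uv D) wuv b≢w
    with (b ≟ x D) ⊎-dec (b ≟ y D) | (b ≟ u D) ⊎-dec (b ≟ v D)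
  ... | yes b∈xy | _ = crossing D b∈xy q∈uv bq
  ... | no _ | yes b∈uv = crossing (exchange D) b∈uv p∈xy bp
  ... | no b∉xy | no b∉uv =
    extend D ((b , p) ∷ (b , q) ∷ []) (((λ { refl → b∉xy p∈xy }) , bp) ∷ ((λ { refl → b∉uv q∈uv }) , bq) ∷ [])
      ((apart (inj₂ refl) p∉bq ∷ []) ∷ [] ∷ [])
      (apart-outside D (inj₁ refl) (b∉xy , b∉uv) ∷ apart-outside D (inj₁ refl) (b∉xy , b∉uv) ∷ [])
      ≤-refl
    where
    p∉bq : p ∉₂ (b , q)
    p∉bq (inj₁ refl) = b∉xy p∈xy
    p∉bq (inj₂ refl) = ∈xy⇒∉uv D p∈xy q∈uv

  apex-or-non-edge : ∀ D {w} → Outside D w →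
    NonEdges G 4 ⊎ ∃ λ z → (z ∈₂ (x D , y D) ⊎ z ∈₂ (u D , v D)) × NonAdjacent G w z
  apex-or-non-edge D {w} (w∉xy , w∉uv)
    with adj G w (x D) in wx | adj G w (y D) in wy | adj G w (u D) in wu | adj G w (v D) in wv
  ... | false | _ | _ | _ = inj₂ (_ , inj₁ (inj₁ refl) , w∉xy ∘ inj₁ , wx)
  ... | true | false | _ | _ = inj₂ (_ , inj₁ (inj₂ refl) , w∉xy ∘ inj₂ , wy)
  ... | true | true | false | _ = inj₂ (_ , inj₂ (inj₁ refl) , w∉uv ∘ inj₁ , wu)
  ... | true | true | true | false = inj₂ (_ , inj₂ (inj₂ refl) , w∉uv ∘ inj₂ , wv)
  ... | true | true | true | true = inj₁ (four-from-apex D (wx , wy) (wu , wv))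

  two-disjoint-non-edges : 3 ≤ n → DisjointNonEdges G
  two-disjoint-non-edges 3≤n
    with v₁ , [] ← fresh [] (≤-trans (s≤s z≤n) 3≤n)
    with v₂ , v₂≢v₁ ∷ [] ← fresh (v₁ ∷ []) (≤-trans (s≤s (s≤s z≤n)) 3≤n)
    with w , w≢v₁ ∷ w≢v₂ ∷ [] ← fresh (v₁ ∷ v₂ ∷ []) 3≤n
    with x , y , xy , _ ← joint-non-edge G no-three (v₂≢v₁ ∘ sym) w≢v₁ w≢v₂
    with w′ , w′≢x ∷ w′≢y ∷ [] ← fresh (x ∷ y ∷ []) 3≤n
    with u , v , uv , u∉xy , v∉xy ← disjoint-non-edge G no-three xy [ w′≢x , w′≢y ]
    = record { x = x ; y = y ; u = u ; v = v ; xy = xy ; uv = uv ; u∉xy = u∉xy ; v∉xy = v∉xy }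

  two-non-edges : 3 ≤ n → NonEdges G 2
  two-non-edges 3≤n = extend (two-disjoint-non-edges 3≤n) [] [] [] [] ≤-refl

  three-non-edges : 5 ≤ n → NonEdges G 3
  three-non-edges 5≤n
    with D ← two-disjoint-non-edges (≤-trans (s≤s (s≤s (s≤s z≤n))) 5≤n)
    with w , w∉D ← fresh (vertices D) 5≤n
    with apex-or-non-edge D (outside D w∉D)
  ... | inj₁ four = nonEdges-weaken (n≤1+n 3) four
  ... | inj₂ (_ , _ , wz) =
    extend D (_ ∷ []) (wz ∷ []) ([] ∷ []) (apart-outside D (inj₁ refl) (outside D w∉D) ∷ []) ≤-refl

  four-non-edges : 6 ≤ n → NonEdges G 4
  four-non-edges 6≤n
    with D ← two-disjoint-non-edges (≤-trans (s≤s (s≤s (s≤s z≤n))) 6≤n)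
    with w₁ , w₁∉D ← fresh (vertices D) (≤-trans (n≤1+n 5) 6≤n)
    with apex-or-non-edge D (outside D w₁∉D)
  ... | inj₁ four = four
  ... | inj₂ (z₁ , z₁∈D , w₁z₁)
    with w₂ , w₂≢w₁ ∷ w₂∉D ← fresh (w₁ ∷ vertices D) 6≤n
    with apex-or-non-edge D (outside D w₂∉D)
  ... | inj₁ four = four
  ... | inj₂ (z₂ , z₂∈D , w₂z₂) =
    extend D (_ ∷ _ ∷ []) (w₁z₁ ∷ w₂z₂ ∷ [])
      ((apart (inj₁ refl) w₁∉w₂z₂ ∷ []) ∷ [] ∷ [])
      (apart-outside D (inj₁ refl) (outside D w₁∉D) ∷ apart-outside D (inj₁ refl) (outside D w₂∉D) ∷ [])
      ≤-refl
    where
    w₁∉w₂z₂ : w₁ ∉₂ (w₂ , z₂)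
    w₁∉w₂z₂ (inj₁ refl) = w₂≢w₁ refl
    w₁∉w₂z₂ (inj₂ refl) = [ proj₁ (outside D w₁∉D) , proj₂ (outside D w₁∉D) ] z₂∈D

-- The extremal graphs

≟-sym : ∀ {n} (i j : Fin n) → ⌊ i ≟ j ⌋ ≡ ⌊ j ≟ i ⌋
≟-sym i j with i ≟ j | j ≟ i
... | yes _ | yes _ = refl
... | no _ | no _ = refl
... | yes i≡j | no j≢i = ⊥-elim (j≢i (sym i≡j))
... | no i≢j | yes j≡i = ⊥-elim (i≢j (sym j≡i))

≟-refl : ∀ {n} (i : Fin n) → ⌊ i ≟ i ⌋ ≡ true
≟-refl i with i ≟ i
... | yes _ = refl
... | no i≢i = ⊥-elim (i≢i refl)

complementOf : ∀ {n} → (Fin n → Fin n → Bool) → Graph n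
complementOf E = record
  { adj = λ i j → not (⌊ i ≟ j ⌋ ∨ E i j ∨ E j i)
  ; sym = λ i j → cong not (cong₂ _∨_ (≟-sym i j) (Bool.∨-comm (E i j) (E j i)))
  ; irrefl = λ i → cong (λ b → not (b ∨ E i i ∨ E i i)) (≟-refl i)
  }

K₂ : Graph 2
K₂ = complementOf λ _ _ → false

K₂-connected : Connected K₂
K₂-connected = connected-via 0F λ { 0F → here refl ; 1F → step (here refl) refl refl }

K₂-mvd≡2 : MVD≡ K₂ 2
K₂-mvd≡2 =
  (id , neighbourhood-mvd K₂ id (from-yes (neighbourhoodCuts? K₂ (monochromatic? id))) , (_, refl))
  , λ m (_ , _ , surj) → surjective⇒≤ surj

C₄ : Graph 4
C₄ = complementOf λ { 0F 1F → true ; 2F 3F → true ; _ _ → false }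

C₄-connected : Connected C₄
C₄-connected = connected-via 0F λ
  { 0F → here refl
  ; 1F → step {y = 2F} (step (here refl) refl refl) refl refl
  ; 2F → step (here refl) refl refl
  ; 3F → step (here refl) refl refl
  }

C₄-mvd≡2 : MVD≡ C₄ 2
C₄-mvd≡2 = (colour , neighbourhood-mvd C₄ id (from-yes (neighbourhoodCuts? C₄ (monochromatic? colour))) , surj)
         , two-colours
  where
  colour : Fin 4 → Fin 2
  colour = λ { 0F → 0F ; 1F → 0F ; 2F → 1F ; 3F → 1F }
  surj : Surjective colour
  surj = λ { 0F → 0F , refl ; 1F → 2F , refl }
  two-colours : ∀ m → HasMVDColoring C₄ m → m ≤ 2
  two-colours m (c , mvd , surj) = at-most-two-colours surj 0F 2F λ
    { 0F → inj₁ refl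
    ; 1F → inj₁ (common-neighbours-same-colour mvd {x = 2F} {3F} ((λ ()) , refl) (refl , refl) (refl , refl))
    ; 2F → inj₂ refl
    ; 3F → inj₂ (common-neighbours-same-colour mvd {x = 0F} {1F} ((λ ()) , refl) (refl , refl) (refl , refl))
    }

co[P₃+K₂] : Graph 5
co[P₃+K₂] = complementOf λ { 0F 1F → true ; 0F 2F → true ; 3F 4F → true ; _ _ → false }

co[P₃+K₂]-connected : Connected co[P₃+K₂]
co[P₃+K₂]-connected = connected-via 3F λ
  { 0F → step (here refl) refl refl
  ; 1F → step (here refl) refl refl
  ; 2F → step (here refl) refl refl
  ; 3F → here refl
  ; 4F → step {y = 0F} (step (here refl) refl refl) refl refl
  }

co[P₃+K₂]-mvd≡2 : MVD≡ co[P₃+K₂] 2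
co[P₃+K₂]-mvd≡2 =
  ( colour
  , neighbourhood-mvd co[P₃+K₂] id (from-yes (neighbourhoodCuts? co[P₃+K₂] (monochromatic? colour)))
  , surj )
  , two-colours
  where
  colour : Fin 5 → Fin 2
  colour = λ { 3F → 1F ; 4F → 1F ; _ → 0F }
  surj : Surjective colour
  surj = λ { 0F → 0F , refl ; 1F → 3F , refl }
  two-colours : ∀ m → HasMVDColoring co[P₃+K₂] m → m ≤ 2
  two-colours m (c , mvd , surj) = at-most-two-colours surj 0F 3F λ
    { 0F → inj₁ refl
    ; 1F → inj₁ (common-neighbours-same-colour mvd {x = 3F} {4F} ((λ ()) , refl) (refl , refl) (refl , refl))
    ; 2F → inj₁ (common-neighbours-same-colour mvd {x = 3F} {4F} ((λ ()) , refl) (refl , refl) (refl , refl))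
    ; 3F → inj₂ refl
    ; 4F → inj₂ (common-neighbours-same-colour mvd {x = 0F} {1F} ((λ ()) , refl) (refl , refl) (refl , refl))
    }

coP₅ : Graph 5
coP₅ = complementOf λ { 0F 1F → true ; 1F 2F → true ; 2F 3F → true ; 3F 4F → true ; _ _ → false }

cone : ∀ {n} → Graph n → Graph (suc n)
cone {n} G = record { adj = adjᶜ ; sym = symᶜ ; irrefl = irreflᶜ }
  where
  adjᶜ : Fin (suc n) → Fin (suc n) → Bool
  adjᶜ zero zero = false
  adjᶜ zero (suc _) = true
  adjᶜ (suc _) zero = true
  adjᶜ (suc i) (suc j) = adj G i j
  symᶜ : ∀ i j → adjᶜ i j ≡ adjᶜ j i
  symᶜ zero zero = refl
  symᶜ zero (suc _) = refl
  symᶜ (suc _) zero = refl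
  symᶜ (suc i) (suc j) = Graph.sym G i j
  irreflᶜ : ∀ i → adjᶜ i i ≡ false
  irreflᶜ zero = refl
  irreflᶜ (suc i) = irrefl G i

module _ {n : ℕ} (G : Graph n) where

  cone-connected : Connected (cone G)
  cone-connected = connected-via zero to-apex
    where
    to-apex : ∀ x → Reach (cone G) ∅ x zero
    to-apex zero = here refl
    to-apex (suc x) = step (here refl) refl refl

  size-cone : size (cone G) ≡ n + size G
  size-cone =
    doubleSum-suc {n} (λ i j → if (toℕ i <ᵇ toℕ j) ∧ adj (cone G) i j then 1 else 0) (λ _ → refl) (λ _ → refl)

  cone-painted : ∀ {k} {c : Fin n → Fin k} {a} →
    NeighbourhoodCuts G (Painted c a) → NeighbourhoodCuts (cone G) (Painted (a ◂ c) a)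
  cone-painted cuts zero zero (0≢0 , _) = ⊥-elim (0≢0 refl)
  cone-painted {c = c} {a} cuts (suc s) (suc t) (s≢t , st) =
    Sum.map extend extend (cuts s t (s≢t ∘ cong suc , st))
    where
    extend : ∀ {u} → Painted c a (adj G u) → Painted (a ◂ c) a (adj (cone G) (suc u))
    extend painted zero _ = refl
    extend painted (suc v) uv = painted v uv

-- K_{k+1} ∨ P̄₅, the extremal graph of order 6 + k; coP₅ sits on the last five vertices.
K∨coP₅ : ∀ k → Graph (6 + k)
K∨coP₅ zero = cone coP₅
K∨coP₅ (suc k) = cone (K∨coP₅ k)

base : ∀ k → Fin 5 → Fin (6 + k)
base zero = suc
base (suc k) = suc ∘ base k

base-nonAdjacent : ∀ k {a b} → NonAdjacent coP₅ a b → NonAdjacent (K∨coP₅ k) (base k a) (base k b)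
base-nonAdjacent zero (a≢b , ab) = a≢b ∘ suc-injective , ab
base-nonAdjacent (suc k) ab with a≢b , ab ← base-nonAdjacent k ab = a≢b ∘ suc-injective , ab

apex-common : ∀ k a b → CommonNeighbour (K∨coP₅ k) (base k a) (base k b) zero
apex-common zero a b = refl , refl
apex-common (suc k) a b = refl , refl

K∨coP₅-connected : ∀ k → Connected (K∨coP₅ k)
K∨coP₅-connected zero = cone-connected coP₅
K∨coP₅-connected (suc k) = cone-connected (K∨coP₅ k)

K∨coP₅-classify : ∀ k v → v ≡ base k 2F
  ⊎ CommonNeighbour (K∨coP₅ k) (base k 0F) (base k 1F) v
  ⊎ CommonNeighbour (K∨coP₅ k) (base k 3F) (base k 4F) v
K∨coP₅-classify k zero = inj₂ (inj₁ (apex-common k 0F 1F))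
K∨coP₅-classify zero (suc 0F) = inj₂ (inj₂ (refl , refl))
K∨coP₅-classify zero (suc 1F) = inj₂ (inj₂ (refl , refl))
K∨coP₅-classify zero (suc 2F) = inj₁ refl
K∨coP₅-classify zero (suc 3F) = inj₂ (inj₁ (refl , refl))
K∨coP₅-classify zero (suc 4F) = inj₂ (inj₁ (refl , refl))
K∨coP₅-classify (suc k) (suc v) = Sum.map₁ (cong suc) (K∨coP₅-classify k v)

K∨coP₅-mvd≤2 : ∀ k m → HasMVDColoring (K∨coP₅ k) m → m ≤ 2
K∨coP₅-mvd≤2 k m (c , mvd , surj) = at-most-two-colours surj zero (base k 2F) colour
  where
  colour : ∀ v → c v ≡ c zero ⊎ c v ≡ c (base k 2F)
  colour v with K∨coP₅-classify k v
  ... | inj₁ refl = inj₂ refl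
  ... | inj₂ (inj₁ v₀₁) =
    inj₁ (common-neighbours-same-colour mvd (base-nonAdjacent k {0F} {1F} ((λ ()) , refl))
            v₀₁ (apex-common k 0F 1F))
  ... | inj₂ (inj₂ v₃₄) =
    inj₁ (common-neighbours-same-colour mvd (base-nonAdjacent k {3F} {4F} ((λ ()) , refl))
            v₃₄ (apex-common k 3F 4F))

-- In P̄₅ the middle vertex is non-adjacent only to 1 and 3, and every non-edge contains 1 or 3,
-- so giving it its own colour leaves a neighbourhood of colour 0 at every non-edge.
coP₅-colouring : Fin 5 → Fin 2
coP₅-colouring 2F = 1F
coP₅-colouring _ = 0F

K∨coP₅-colouring : ∀ k → Fin (6 + k) → Fin 2
K∨coP₅-colouring zero = 0F ◂ coP₅-colouring
K∨coP₅-colouring (suc k) = 0F ◂ K∨coP₅-colouring k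

K∨coP₅-painted : ∀ k → NeighbourhoodCuts (K∨coP₅ k) (Painted (K∨coP₅-colouring k) 0F)
K∨coP₅-painted zero = cone-painted coP₅ (from-yes (neighbourhoodCuts? coP₅ (painted? coP₅-colouring 0F)))
K∨coP₅-painted (suc k) = cone-painted (K∨coP₅ k) (K∨coP₅-painted k)

K∨coP₅-colouring-surjective : ∀ k → Surjective (K∨coP₅-colouring k)
K∨coP₅-colouring-surjective k 0F = zero , apex-colour k
  where
  apex-colour : ∀ k → K∨coP₅-colouring k zero ≡ 0F
  apex-colour zero = refl
  apex-colour (suc k) = refl
K∨coP₅-colouring-surjective k 1F = base k 2F , middle-colour k
  where
  middle-colour : ∀ k → K∨coP₅-colouring k (base k 2F) ≡ 1F
  middle-colour zero = refl
  middle-colour (suc k) = middle-colour k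

K∨coP₅-mvd≡2 : ∀ k → MVD≡ (K∨coP₅ k) 2
K∨coP₅-mvd≡2 k =
  ( K∨coP₅-colouring k
  , neighbourhood-mvd (K∨coP₅ k) painted⇒monochromatic (K∨coP₅-painted k)
  , K∨coP₅-colouring-surjective k )
  , K∨coP₅-mvd≤2 k

K∨coP₅-size : ∀ k → size (K∨coP₅ k) + 4 ≡ pairCount (6 + k)
K∨coP₅-size zero = refl
K∨coP₅-size (suc k) = begin
  size (cone (K∨coP₅ k)) + 4     ≡⟨ cong (_+ 4) (size-cone (K∨coP₅ k)) ⟩
  6 + k + size (K∨coP₅ k) + 4    ≡⟨ +-assoc (6 + k) (size (K∨coP₅ k)) 4 ⟩
  6 + k + (size (K∨coP₅ k) + 4)  ≡⟨ cong (6 + k +_) (K∨coP₅-size k) ⟩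
  6 + k + pairCount (6 + k)      ≡⟨ pairCount-suc (6 + k) ⟨
  pairCount (7 + k)              ∎
  where open ≡-Reasoning

order-two : MaxSizeMVD2 2 1
order-two = (K₂ , K₂-connected , K₂-mvd≡2 , refl) , λ G _ _ → size-bound {G = G} (nonEdges [] [] [] z≤n)

outside-pair-unique : ∀ (x y u v : Fin 3) → x ≢ y → u ∉₂ (x , y) → v ∉₂ (x , y) → u ≡ v
outside-pair-unique = from-yes decision
  where
  decision : Dec (∀ (x y u v : Fin 3) → x ≢ y → u ∉₂ (x , y) → v ∉₂ (x , y) → u ≡ v)
  decision = all? λ x → all? λ y → all? λ u → all? λ v →
    ¬? (x ≟ y) →-dec ¬? ((u ≟ x) ⊎-dec (u ≟ y)) →-dec ¬? ((v ≟ x) ⊎-dec (v ≟ y)) →-dec (u ≟ v)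

order-three : ∀ (G : Graph 3) → Connected G → ¬ MVD≡ G 2
order-three G _ mvd≡2 = proj₁ uv (outside-pair-unique x y u v (proj₁ xy) u∉xy v∉xy)
  where open DisjointNonEdges (ForcedNonEdges.two-disjoint-non-edges G mvd≡2 ≤-refl)

order-four : MaxSizeMVD2 4 4
order-four = (C₄ , C₄-connected , C₄-mvd≡2 , refl)
           , λ G _ mvd≡2 → size-bound (ForcedNonEdges.two-non-edges G mvd≡2 (s≤s (s≤s (s≤s z≤n))))

order-five : MaxSizeMVD2 5 7
order-five = (co[P₃+K₂] , co[P₃+K₂]-connected , co[P₃+K₂]-mvd≡2 , refl)
           , λ G _ mvd≡2 → size-bound (ForcedNonEdges.three-non-edges G mvd≡2 ≤-refl)

order≥6 : ∀ n → 6 ≤ n → MaxSizeMVD2 n (n * (n ∸ 1) / 2 ∸ 4)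
order≥6 n 6≤n with k , refl ← m≤n⇒∃[o]m+o≡n 6≤n =
  subst (λ m → MaxSizeMVD2 n (m ∸ 4)) (pairCount≡ n)
    ( (K∨coP₅ k , K∨coP₅-connected k , K∨coP₅-mvd≡2 k , size≡)
    , λ G _ mvd≡2 → size-bound (ForcedNonEdges.four-non-edges G mvd≡2 6≤n))
  where
  size≡ : size (K∨coP₅ k) ≡ pairCount (6 + k) ∸ 4
  size≡ = trans (sym (m+n∸n≡m _ 4)) (cong (_∸ 4) (K∨coP₅-size k))

lemma4p2 : MaxSizeMVD2 2 1
    × (∀ (G : Graph 3) → Connected G → ¬ MVD≡ G 2)
    × MaxSizeMVD2 4 4
    × MaxSizeMVD2 5 7
    × (∀ (n : ℕ) → 6 ≤ n → MaxSizeMVD2 n (n * (n ∸ 1) / 2 ∸ 4))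
lemma4p2 = order-two , order-three , order-four , order-five , order≥6
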